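{- The logic $\mathbf{IL}^-(\mathbf{J2}_+,\mathbf{J5})$ does not have the finite model property with respect to simplified $\mathbf{IL}^-(\mathbf{J2}_+,\mathbf{J5})$-frames; that is, there is a modal formula $A$ with $\mathbf{IL}^-(\mathbf{J2}_+,\mathbf{J5})\nvdash A$ that is valid in every finite simplified $\mathbf{IL}^-(\mathbf{J2}_+,\mathbf{J5})$-frame.
   Context: Modal formulas are built from propositional variables, $\top,\bot$, connectives $\to,\lor,\land$, the unary modality $\Box$ and the binary modality $\rhd$; $\Diamond A:=\neg\Box\neg A$. The logic $\mathbf{IL}^-$ has as axioms: all tautologies; $\Box(A\to B)\to(\Box A\to\Box B)$; $\Box(\Box A\to A)\to\Box A$; $\mathbf{J3}$: $(A\rhd C)\land(B\rhd C)\to(A\lor B)\rhd C$; $\mathbf{J6}$: $\Box\neg A\leftrightarrow A\rhd\bot$; and as rules: modus ponens, necessitation, $\mathbf{R1}$: from $A\to B$ infer $C\rhd A\to C\rhd B$, and $\mathbf{R2}$: from $A\to B$ infer $B\rhd C\to A\rhd C$. $\mathbf{IL}^-(\mathbf{J2}_+,\mathbf{J5})$ is $\mathbf{IL}^-$ plus the schemes $\mathbf{J2}_+$: $A\rhd(B\lor C)\land B\rhd C\to A\rhd C$ and $\mathbf{J5}$: $\Diamond A\rhd A$. A simplified frame is a triple $(W,R,S)$ with $W$ a non-empty set, $R$ a transitive, conversely well-founded relation on $W$, and $S$ a binary relation on $W$; it is finite if $W$ is finite. Forcing in a model on it is standard for Boolean connectives, $x\Vdash\Box A$ iff $y\Vdash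 A$ for all $y$ with $xRy$, and $x\Vdash A\rhd B$ iff for every $y$ with $xRy$ and $y\Vdash A$ there is $z$ with $xRz$, $ySz$ and $z\Vdash B$. Validity in a frame means being forced at every point under every valuation. A simplified $\mathbf{IL}^-(\mathbf{J2}_+,\mathbf{J5})$-frame is such a frame in which $S$ is transitive and $R\subseteq S$. -}

module Defs where

open import Data.Nat using (ℕ; suc)
open import Data.Fin using (Fin)
open import Data.Bool using (Bool; true; false; not; _∧_; _∨_)
open import Data.List using (allFin)
open import Data.Bool.ListAction using (all; any)
open import Data.Product using (Σ; _×_)
open import Relation.Binary.PropositionalEquality using (_≡_)
open import Induction.WellFounded using (WellFounded)

infixr 6 _∧'_
infixr 5 _∨'_
infixr 4 _⇒_
infix  7 _▷_

data Fm : Set where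
  var  : ℕ → Fm
  ⊤'   : Fm
  ⊥'   : Fm
  _⇒_  : Fm → Fm → Fm
  _∨'_ : Fm → Fm → Fm
  _∧'_ : Fm → Fm → Fm
  □    : Fm → Fm
  _▷_  : Fm → Fm → Fm

¬' : Fm → Fm
¬' A = A ⇒ ⊥'

◇ : Fm → Fm
◇ A = ¬' (□ (¬' A))

_⇔_ : Fm → Fm → Fm
A ⇔ B = (A ⇒ B) ∧' (B ⇒ A)

-- Tautologies: formulas true under every Boolean assignment to their
-- propositional atoms, where variables, □-formulas and ▷-formulas are
-- treated as atoms (i.e. substitution instances of propositional
-- tautologies).

evalP : (Fm → Bool) → Fm → Bool
evalP v (var p)  = v (var p)
evalP v ⊤'       = true
evalP v ⊥'       = false
evalP v (A ⇒ B)  = not (evalP v A) ∨ evalP v B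
evalP v (A ∨' B) = evalP v A ∨ evalP v B
evalP v (A ∧' B) = evalP v A ∧ evalP v B
evalP v (□ A)    = v (□ A)
evalP v (A ▷ B)  = v (A ▷ B)

Tautology : Fm → Set
Tautology A = (v : Fm → Bool) → evalP v A ≡ true

infix 2 ⊢_

data ⊢_ : Fm → Set where
  taut : ∀ {A} → Tautology A → ⊢ A
  axK  : ∀ {A B} → ⊢ □ (A ⇒ B) ⇒ (□ A ⇒ □ B)
  axL  : ∀ {A} → ⊢ □ (□ A ⇒ A) ⇒ □ A
  axJ3 : ∀ {A B C} → ⊢ ((A ▷ C) ∧' (B ▷ C)) ⇒ ((A ∨' B) ▷ C)
  axJ6 : ∀ {A} → ⊢ □ (¬' A) ⇔ (A ▷ ⊥')
  axJ2+ : ∀ {A B C} → ⊢ ((A ▷ (B ∨' C)) ∧' (B ▷ C)) ⇒ (A ▷ C)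
  axJ5 : ∀ {A} → ⊢ (◇ A) ▷ A
  mp   : ∀ {A B} → ⊢ A ⇒ B → ⊢ A → ⊢ B
  nec  : ∀ {A} → ⊢ A → ⊢ □ A
  R1   : ∀ {A B C} → ⊢ A ⇒ B → ⊢ (C ▷ A) ⇒ (C ▷ B)
  R2   : ∀ {A B C} → ⊢ A ⇒ B → ⊢ (B ▷ C) ⇒ (A ▷ C)

record FiniteFrame : Set where
  field
    size : ℕ
    R    : Fin (suc size) → Fin (suc size) → Bool
    S    : Fin (suc size) → Fin (suc size) → Bool

  W : Set
  W = Fin (suc size)

  _R'_ : W → W → Set
  x R' y = R x y ≡ true

  _S'_ : W → W → Set
  x S' y = S x y ≡ true

  field
    R-trans : ∀ x y z → x R' y → y R' z → x R' z
    R-cwf   : WellFounded (λ y x → x R' y)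

open FiniteFrame public

IsJ2+J5Frame : FiniteFrame → Set
IsJ2+J5Frame F =
  (∀ x y z → _S'_ F x y → _S'_ F y z → _S'_ F x z) ×
  (∀ x y → _R'_ F x y → _S'_ F x y)

Valuation : FiniteFrame → Set
Valuation F = ℕ → W F → Bool

forces : (F : FiniteFrame) → Valuation F → W F → Fm → Bool
forces F V x (var p)  = V p x
forces F V x ⊤'       = true
forces F V x ⊥'       = false
forces F V x (A ⇒ B)  = not (forces F V x A) ∨ forces F V x B
forces F V x (A ∨' B) = forces F V x A ∨ forces F V x B
forces F V x (A ∧' B) = forces F V x A ∧ forces F V x B
forces F V x (□ A)    =
  all (λ y → not (R F x y) ∨ forces F V y A) (allFin (suc (size F)))
forces F V x (A ▷ B)  =
  all (λ y → not (R F x y ∧ forces F V y A)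
             ∨ any (λ z → R F x z ∧ S F y z ∧ forces F V z B)
                   (allFin (suc (size F))))
      (allFin (suc (size F)))

ValidIn : FiniteFrame → Fm → Set
ValidIn F A = (V : Valuation F) → (x : W F) → forces F V x A ≡ true

-- Let Ψ = (⊤ ▷ ¬(⊤ ▷ ⊤)) → □⊥, and let x ⊩ ⊤ ▷ ¬(⊤ ▷ ⊤) in a frame with S transitive and
-- R ⊆ S. For each R-successor u of x there is a z with xRz, uSz and z ⊮ ⊤ ▷ ⊤, i.e. a v
-- with zRv and no S-successor among the R-successors of z; so xRv, uSv and not vSv. Then
-- the set of S-successors of v is strictly contained in that of u, so in a finite frame
-- x can have no R-successor at all, and x ⊩ □⊥.
-- Ψ is not derivable: it fails at 0 in the generalised Veltman frame on {0, 1, 2} with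
-- 0R1, 0R2, 1R2 and S₀ = {1, 2}², S₁ = S₂ = ∅, for which the logic is sound. Every axiom
-- scheme has at most three letters, so its validity there is a finite truth-table check.
module Submission where

open import Defs
open import Data.Bool using (Bool; true; false; not; _∧_; _∨_)
open import Data.Bool.ListAction using (and; or; all; any)
open import Data.Bool.Properties using (∨-conicalˡ; ∨-conicalʳ; not-¬)
open import Data.Empty using (⊥-elim)
open import Data.Fin using (Fin; zero; suc)
open import Data.Fin.Subset using (Subset; _∈_; _⊂_)
open import Data.Fin.Subset.Induction using (⊂-wellFounded)
open import Data.List using (List; []; _∷_; allFin)
open import Data.List.Membership.Propositional using () renaming (_∈_ to _∈ˡ_)
open import Data.List.Membership.Propositional.Properties using (∈-allFin)
open import Data.List.Properties using (map-cong)
open import Data.List.Relation.Unary.Any using (here; there)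
open import Data.Nat using (ℕ; suc)
open import Data.Product using (Σ; _×_; _,_; ∃; proj₁; proj₂)
open import Data.Vec using (tabulate)
open import Data.Vec.Properties using (lookup∘tabulate; []=⇒lookup; lookup⇒[]=)
open import Induction.WellFounded using (Acc; acc)
open import Relation.Nullary using (¬_)
open import Relation.Binary.PropositionalEquality using (_≡_; refl; sym; trans; cong; cong₂)

⇒-intro : ∀ {a b} → (a ≡ true → b ≡ true) → not a ∨ b ≡ true
⇒-intro {false} _ = refl
⇒-intro {true}  h = h refl

⇒-elim : ∀ {a b} → not a ∨ b ≡ true → a ≡ true → b ≡ true
⇒-elim h refl = h

∧-split : ∀ {a b} → a ∧ b ≡ true → a ≡ true × b ≡ true
∧-split {true} h = refl , h

∧-falseʳ : ∀ {a b} → a ≡ true → a ∧ b ≡ false → b ≡ false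
∧-falseʳ refl h = h

⇒-refute : ∀ {a b} → not a ∨ b ≡ false → a ≡ true × b ≡ false
⇒-refute {true} h = refl , h

¬-elim : ∀ {a} → not a ∨ false ≡ true → a ≡ false
¬-elim {false} _ = refl

module _ {A : Set} (p : A → Bool) where

  all-sound : ∀ {xs} → all p xs ≡ true → ∀ {x} → x ∈ˡ xs → p x ≡ true
  all-sound h (here refl) = proj₁ (∧-split h)
  all-sound {y ∷ _} h (there x∈) = all-sound (proj₂ (∧-split {p y} h)) x∈

  all-complete : (∀ x → p x ≡ true) → ∀ xs → all p xs ≡ true
  all-complete h []       = refl
  all-complete h (y ∷ ys) rewrite h y = all-complete h ys

  all-counterexample : ∀ xs → all p xs ≡ false → ∃ λ x → p x ≡ false
  all-counterexample (y ∷ ys) h with p y in py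
  ... | false = y , py
  ... | true  = all-counterexample ys h

  any-witness : ∀ xs → any p xs ≡ true → ∃ λ x → p x ≡ true
  any-witness (y ∷ ys) h with p y in py
  ... | true  = y , py
  ... | false = any-witness ys h

  any-refuted : ∀ {xs} → any p xs ≡ false → ∀ {x} → x ∈ˡ xs → p x ≡ false
  any-refuted h (here refl) = ∨-conicalˡ _ _ h
  any-refuted {y ∷ _} h (there x∈) = any-refuted (∨-conicalʳ (p y) _ h) x∈

module _ {A : Set} {p q : A → Bool} (p≗q : ∀ x → p x ≡ q x) where

  all-cong : ∀ xs → all p xs ≡ all q xs
  all-cong xs = cong and (map-cong p≗q xs)

  any-cong : ∀ xs → any p xs ≡ any q xs
  any-cong xs = cong or (map-cong p≗q xs)

module _ {n : ℕ} (S : Fin n → Fin n → Bool) where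

  successors : Fin n → Subset n
  successors u = tabulate (S u)

  ∈-successors⁺ : ∀ {u v} → S u v ≡ true → v ∈ successors u
  ∈-successors⁺ {u} {v} uSv = lookup⇒[]= v (successors u) (trans (lookup∘tabulate (S u) v) uSv)

  ∈-successors⁻ : ∀ {u v} → v ∈ successors u → S u v ≡ true
  ∈-successors⁻ {u} {v} v∈ = trans (sym (lookup∘tabulate (S u) v)) ([]=⇒lookup v∈)

  successors-⊂ : (∀ x y z → S x y ≡ true → S y z ≡ true → S x z ≡ true) →
    ∀ {u v} → S u v ≡ true → ¬ (S v v ≡ true) → successors v ⊂ successors u
  successors-⊂ S-trans {u} {v} uSv v≮v =
    (λ w∈ → ∈-successors⁺ (S-trans u v _ uSv (∈-successors⁻ w∈))) ,
    v , ∈-successors⁺ uSv , λ v∈ → v≮v (∈-successors⁻ v∈)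

  irreflexive-ascent⇒empty : (∀ x y z → S x y ≡ true → S y z ≡ true → S x z ≡ true) →
    (P : Fin n → Set) → (∀ {u} → P u → ∃ λ v → P v × S u v ≡ true × ¬ (S v v ≡ true)) →
    ∀ u → ¬ P u
  irreflexive-ascent⇒empty S-trans P ascend u = go u (⊂-wellFounded (successors u))
    where
    go : ∀ u → Acc _⊂_ (successors u) → ¬ P u
    go u (acc rs) pu with ascend pu
    ... | v , pv , uSv , v≮v = go v (rs (successors-⊂ S-trans uSv v≮v)) pv

module _ (F : FiniteFrame) (V : Valuation F) where

  worlds : List (W F)
  worlds = allFin (suc (size F))

  □-intro : ∀ {x A} → (∀ y → R F x y ≡ true → forces F V y A ≡ true) →
            forces F V x (□ A) ≡ true
  □-intro h = all-complete _ (λ y → ⇒-intro (h y)) worlds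

  ▷-witness : W F → W F → Fm → W F → Bool
  ▷-witness x y B z = R F x z ∧ S F y z ∧ forces F V z B

  ▷-answered : W F → Fm → Fm → W F → Bool
  ▷-answered x A B y = not (R F x y ∧ forces F V y A) ∨ any (▷-witness x y B) worlds

  ▷-elim : ∀ {x y A B} → forces F V x (A ▷ B) ≡ true →
           R F x y ≡ true → forces F V y A ≡ true →
           ∃ λ z → R F x z ≡ true × S F y z ≡ true × forces F V z B ≡ true
  ▷-elim {x} {y} {A} {B} h xRy yA
    with z , found ← any-witness (▷-witness x y B) worlds
                       (⇒-elim (all-sound (▷-answered x A B) h (∈-allFin y)) (cong₂ _∧_ xRy yA))
    with xRz , rest ← ∧-split found
    with ySz , zB ← ∧-split rest
    = z , xRz , ySz , zB

  ▷-refute : ∀ {x A B} → forces F V x (A ▷ B) ≡ false →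
             ∃ λ y → R F x y ≡ true × forces F V y A ≡ true ×
                     (∀ z → R F x z ≡ true → S F y z ≡ true → ¬ (forces F V z B ≡ true))
  ▷-refute {x} {A} {B} h
    with y , unanswered ← all-counterexample (▷-answered x A B) worlds h
    with asked , no-witness ← ⇒-refute unanswered
    with xRy , yA ← ∧-split asked
    = y , xRy , yA , λ z xRz ySz zB →
        not-¬ zB (∧-falseʳ ySz (∧-falseʳ xRz
          (any-refuted (▷-witness x y B) no-witness (∈-allFin z))))

Ψ : Fm
Ψ = (⊤' ▷ ¬' (⊤' ▷ ⊤')) ⇒ □ ⊥'

Ψ-antecedent-ascends : (F : FiniteFrame) → IsJ2+J5Frame F → ∀ V x →
  forces F V x (⊤' ▷ ¬' (⊤' ▷ ⊤')) ≡ true →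
  ∀ {u} → R F x u ≡ true → ∃ λ v → R F x v ≡ true × S F u v ≡ true × ¬ (S F v v ≡ true)
Ψ-antecedent-ascends F (S-trans , R⊆S) V x h {u} xRu
  with z , xRz , uSz , z⊮⊤▷⊤ ← ▷-elim F V {A = ⊤'} {B = ¬' (⊤' ▷ ⊤')} h xRu refl
  with v , zRv , _ , no-witness ← ▷-refute F V {A = ⊤'} {B = ⊤'} (¬-elim z⊮⊤▷⊤)
  = v , R-trans F x z v xRz zRv , S-trans u z v uSz (R⊆S z v zRv) ,
    λ vSv → no-witness v zRv vSv refl

Ψ-valid : (F : FiniteFrame) → IsJ2+J5Frame F → ValidIn F Ψ
Ψ-valid F isF V x = ⇒-intro λ h → □-intro F V {A = ⊥'} λ y xRy →
  ⊥-elim (irreflexive-ascent⇒empty (S F) (proj₁ isF) (λ u → R F x u ≡ true)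
            (Ψ-antecedent-ascends F isF V x h) y xRy)

W₃ : Set
W₃ = Fin 3

R₃ : W₃ → W₃ → Bool
R₃ zero       (suc _)          = true
R₃ (suc zero) (suc (suc zero)) = true
R₃ _          _                = false

-- S₃ x y z means y S_x z.
S₃ : W₃ → W₃ → W₃ → Bool
S₃ zero (suc _) (suc _) = true
S₃ _    _       _       = false

Valuation₃ : Set
Valuation₃ = ℕ → W₃ → Bool

forces₃ : Valuation₃ → W₃ → Fm → Bool
forces₃ V x (var p)  = V p x
forces₃ V x ⊤'       = true
forces₃ V x ⊥'       = false
forces₃ V x (A ⇒ B)  = not (forces₃ V x A) ∨ forces₃ V x B
forces₃ V x (A ∨' B) = forces₃ V x A ∨ forces₃ V x B
forces₃ V x (A ∧' B) = forces₃ V x A ∧ forces₃ V x B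
forces₃ V x (□ A)    = all (λ y → not (R₃ x y) ∨ forces₃ V y A) (allFin 3)
forces₃ V x (A ▷ B)  =
  all (λ y → not (R₃ x y ∧ forces₃ V y A)
             ∨ any (λ z → R₃ x z ∧ S₃ x y z ∧ forces₃ V z B) (allFin 3))
      (allFin 3)

forces₃-cong : ∀ {V V′} → (∀ p y → V p y ≡ V′ p y) → ∀ x A → forces₃ V x A ≡ forces₃ V′ x A
forces₃-cong V≗V′ x (var p)  = V≗V′ p x
forces₃-cong V≗V′ x ⊤'       = refl
forces₃-cong V≗V′ x ⊥'       = refl
forces₃-cong V≗V′ x (A ⇒ B)  =
  cong₂ (λ a b → not a ∨ b) (forces₃-cong V≗V′ x A) (forces₃-cong V≗V′ x B)
forces₃-cong V≗V′ x (A ∨' B) = cong₂ _∨_ (forces₃-cong V≗V′ x A) (forces₃-cong V≗V′ x B)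
forces₃-cong V≗V′ x (A ∧' B) = cong₂ _∧_ (forces₃-cong V≗V′ x A) (forces₃-cong V≗V′ x B)
forces₃-cong V≗V′ x (□ A)    =
  all-cong (λ y → cong (not (R₃ x y) ∨_) (forces₃-cong V≗V′ y A)) (allFin 3)
forces₃-cong V≗V′ x (A ▷ B)  =
  all-cong (λ y → cong₂ (λ a b → not (R₃ x y ∧ a) ∨ b) (forces₃-cong V≗V′ y A)
                    (any-cong (λ z → cong (λ c → R₃ x z ∧ S₃ x y z ∧ c) (forces₃-cong V≗V′ z B))
                              (allFin 3)))
           (allFin 3)

evalP-forces₃ : ∀ V x A → evalP (forces₃ V x) A ≡ forces₃ V x A
evalP-forces₃ V x (var p)  = refl
evalP-forces₃ V x ⊤'       = refl
evalP-forces₃ V x ⊥'       = refl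
evalP-forces₃ V x (A ⇒ B)  =
  cong₂ (λ a b → not a ∨ b) (evalP-forces₃ V x A) (evalP-forces₃ V x B)
evalP-forces₃ V x (A ∨' B) = cong₂ _∨_ (evalP-forces₃ V x A) (evalP-forces₃ V x B)
evalP-forces₃ V x (A ∧' B) = cong₂ _∧_ (evalP-forces₃ V x A) (evalP-forces₃ V x B)
evalP-forces₃ V x (□ A)    = refl
evalP-forces₃ V x (A ▷ B)  = refl

□₃-intro : ∀ V A → (∀ y → forces₃ V y A ≡ true) → ∀ x → forces₃ V x (□ A) ≡ true
□₃-intro V A A-valid x =
  all-complete (λ y → not (R₃ x y) ∨ forces₃ V y A) (λ y → ⇒-intro (λ _ → A-valid y)) (allFin 3)

table : Bool → Bool → Bool → W₃ → Bool
table a b c zero             = a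
table a b c (suc zero)       = b
table a b c (suc (suc zero)) = c

tabulate₃ : (W₃ → Bool) → W₃ → Bool
tabulate₃ f = table (f zero) (f (suc zero)) (f (suc (suc zero)))

tabulate₃-≗ : ∀ f y → f y ≡ tabulate₃ f y
tabulate₃-≗ f zero             = refl
tabulate₃-≗ f (suc zero)       = refl
tabulate₃-≗ f (suc (suc zero)) = refl

∀ᵇ : (Bool → Bool) → Bool
∀ᵇ q = q true ∧ q false

∀ᵇ-elim : ∀ q → ∀ᵇ q ≡ true → ∀ b → q b ≡ true
∀ᵇ-elim q h true  = proj₁ (∧-split h)
∀ᵇ-elim q h false = proj₂ (∧-split {q true} h)

∀ᵖ : ((W₃ → Bool) → Bool) → Bool
∀ᵖ Q = ∀ᵇ λ a → ∀ᵇ λ b → ∀ᵇ λ c → Q (table a b c)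

∀ᵖ-elim : ∀ Q → ∀ᵖ Q ≡ true → ∀ f → Q (tabulate₃ f) ≡ true
∀ᵖ-elim Q h f =
  ∀ᵇ-elim (λ c → Q (table a b c))
    (∀ᵇ-elim (λ b → ∀ᵇ λ c → Q (table a b c))
      (∀ᵇ-elim (λ a → ∀ᵇ λ b → ∀ᵇ λ c → Q (table a b c)) h a) b) c
  where
  a = f zero
  b = f (suc zero)
  c = f (suc (suc zero))

p q r : Fm
p = var 0
q = var 1
r = var 2

letters : (W₃ → Bool) → (W₃ → Bool) → (W₃ → Bool) → Valuation₃
letters f g h 0 = f
letters f g h 1 = g
letters f g h 2 = h
letters f g h _ = λ _ → false

holds₃ : Fm → (W₃ → Bool) → (W₃ → Bool) → (W₃ → Bool) → Bool
holds₃ σ f g h = all (λ x → forces₃ (letters f g h) x σ) (allFin 3)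

schema-valid? : Fm → Bool
schema-valid? σ = ∀ᵖ λ f → ∀ᵖ λ g → ∀ᵖ (holds₃ σ f g)

schema-sound : ∀ σ → schema-valid? σ ≡ true → ∀ f g h x → forces₃ (letters f g h) x σ ≡ true
schema-sound σ valid f g h x =
  trans (forces₃-cong tabulated x σ)
        (all-sound (λ x → forces₃ (letters f′ g′ h′) x σ) valid-at-tables (∈-allFin x))
  where
  f′ g′ h′ : W₃ → Bool
  f′ = tabulate₃ f
  g′ = tabulate₃ g
  h′ = tabulate₃ h

  valid-at-tables : holds₃ σ f′ g′ h′ ≡ true
  valid-at-tables =
    ∀ᵖ-elim (holds₃ σ f′ g′)
      (∀ᵖ-elim (λ g → ∀ᵖ (holds₃ σ f′ g))
        (∀ᵖ-elim (λ f → ∀ᵖ λ g → ∀ᵖ (holds₃ σ f g)) valid f) g) h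

  tabulated : ∀ n y → letters f g h n y ≡ letters f′ g′ h′ n y
  tabulated 0                   = tabulate₃-≗ f
  tabulated 1                   = tabulate₃-≗ g
  tabulated 2                   = tabulate₃-≗ h
  tabulated (suc (suc (suc _))) _ = refl

truth-set₃ : Valuation₃ → Fm → W₃ → Bool
truth-set₃ V A y = forces₃ V y A

-- Forcing of σ under letters (truth-set₃ V A) (truth-set₃ V B) (truth-set₃ V C) is
-- definitionally forcing of the instance σ[A, B, C / p, q, r] under V.
sound₃ : ∀ {A} → ⊢ A → ∀ V x → forces₃ V x A ≡ true
sound₃ (taut {A} t) V x = trans (sym (evalP-forces₃ V x A)) (t (forces₃ V x))
sound₃ (axK {A} {B}) V x =
  schema-sound (□ (p ⇒ q) ⇒ (□ p ⇒ □ q)) refl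
    (truth-set₃ V A) (truth-set₃ V B) (truth-set₃ V ⊤') x
sound₃ (axL {A}) V x =
  schema-sound (□ (□ p ⇒ p) ⇒ □ p) refl
    (truth-set₃ V A) (truth-set₃ V ⊤') (truth-set₃ V ⊤') x
sound₃ (axJ3 {A} {B} {C}) V x =
  schema-sound (((p ▷ r) ∧' (q ▷ r)) ⇒ ((p ∨' q) ▷ r)) refl
    (truth-set₃ V A) (truth-set₃ V B) (truth-set₃ V C) x
sound₃ (axJ6 {A}) V x =
  schema-sound (□ (¬' p) ⇔ (p ▷ ⊥')) refl
    (truth-set₃ V A) (truth-set₃ V ⊤') (truth-set₃ V ⊤') x
sound₃ (axJ2+ {A} {B} {C}) V x =
  schema-sound (((p ▷ (q ∨' r)) ∧' (q ▷ r)) ⇒ (p ▷ r)) refl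
    (truth-set₃ V A) (truth-set₃ V B) (truth-set₃ V C) x
sound₃ (axJ5 {A}) V x =
  schema-sound (◇ p ▷ p) refl
    (truth-set₃ V A) (truth-set₃ V ⊤') (truth-set₃ V ⊤') x
sound₃ (mp ⊢A⇒B ⊢A) V x = ⇒-elim (sound₃ ⊢A⇒B V x) (sound₃ ⊢A V x)
sound₃ (nec {A} ⊢A) V x = □₃-intro V A (λ y → sound₃ ⊢A V y) x
sound₃ (R1 {A} {B} {C} ⊢A⇒B) V x =
  ⇒-elim (schema-sound (□ (p ⇒ q) ⇒ ((r ▷ p) ⇒ (r ▷ q))) refl
                   (truth-set₃ V A) (truth-set₃ V B) (truth-set₃ V C) x)
         (□₃-intro V (A ⇒ B) (λ y → sound₃ ⊢A⇒B V y) x)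
sound₃ (R2 {A} {B} {C} ⊢A⇒B) V x =
  ⇒-elim (schema-sound (□ (p ⇒ q) ⇒ ((q ▷ r) ⇒ (p ▷ r))) refl
                   (truth-set₃ V A) (truth-set₃ V B) (truth-set₃ V C) x)
         (□₃-intro V (A ⇒ B) (λ y → sound₃ ⊢A⇒B V y) x)

Ψ-underivable : ¬ (⊢ Ψ)
Ψ-underivable ⊢Ψ with sound₃ ⊢Ψ (λ _ _ → false) zero
... | ()

corollary3p4 : Σ Fm (λ A → (¬ (⊢ A)) × ((F : FiniteFrame) → IsJ2+J5Frame F → ValidIn F A))
corollary3p4 = Ψ , Ψ-underivable , Ψ-valid
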